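{- Let $k\in\mathbb{Z}$ and $n,m\in\mathbb{Z}^+$. Then $\chi_{n,k}(K_m)=m$, $\chi_{n,k}(S_m)=2$, and $\chi_{n,k}(F_m)=3$.
   Context: $K_m$ is the complete graph on $m$ vertices; $S_m$ is the star on $m+1$ vertices (one center adjacent to $m$ leaves); $F_m$ is the friendship graph consisting of $m$ copies of the cycle $C_3$ joined at a single common vertex. For a graph $G=(V,E)$, a labeling $\ell:V\to\mathbb{Z}$ is proper if adjacent vertices get distinct labels, its order is the size of its image, and it is a closed coloring with remainder $k\bmod n$ if $\sum_{w\in N[v]}\ell(w)\equiv k\pmod n$ for every $v$, where $N[v]$ is the closed neighborhood of $v$. $\chi_{n,k}(G)$ is the minimum order of a proper closed coloring with remainder $k\bmod n$ (it does not exist if there is none). -}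

module Defs where

open import Data.Bool using (Bool; true; false; _∧_; _∨_; not; if_then_else_)
open import Data.Nat as ℕ using (ℕ; suc; _≤_)
open import Data.Nat.DivMod using (_/_)
open import Data.Fin as Fin using (Fin; zero; suc; toℕ)
open import Data.Integer as ℤ using (ℤ; +_; _-_)
open import Data.Integer.Divisibility using (_∣_)
open import Data.List using (List; length; deduplicate; map; foldr)
open import Data.List.Base using (allFin)
open import Data.Product using (Σ; ∃; _×_; _,_)
open import Relation.Nullary.Decidable using (⌊_⌋)
open import Relation.Binary.PropositionalEquality using (_≡_; _≢_)

-- A finite simple graph on vertex set Fin V, adjacency given by a Boolean
-- relation (symmetric and irreflexive for the graphs below).
record Graph : Set where
  field
    V   : ℕ
    adj : Fin V → Fin V → Bool
open Graph public

Labeling : Graph → Set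
Labeling G = Fin (V G) → ℤ

Proper : (G : Graph) → Labeling G → Set
Proper G ℓ = ∀ v w → adj G v w ≡ true → ℓ v ≢ ℓ w

inN[_] : (G : Graph) → Fin (V G) → Fin (V G) → Bool
inN[ G ] v w = ⌊ v Fin.≟ w ⌋ ∨ adj G v w

closedSum : (G : Graph) → Labeling G → Fin (V G) → ℤ
closedSum G ℓ v = foldr ℤ._+_ (+ 0) (map (λ w → if inN[ G ] v w then ℓ w else + 0) (allFin (V G)))

_≡_[mod_] : ℤ → ℤ → ℤ → Set
a ≡ b [mod n ] = n ∣ (a - b)

ClosedColoring : (G : Graph) → (n k : ℤ) → Labeling G → Set
ClosedColoring G n k ℓ = ∀ v → closedSum G ℓ v ≡ k [mod n ]

order : (G : Graph) → Labeling G → ℕ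
order G ℓ = length (deduplicate ℤ._≟_ (map ℓ (allFin (V G))))

χ[_,_]_≡_ : ℤ → ℤ → Graph → ℕ → Set
χ[ n , k ] G ≡ r =
  (Σ (Labeling G) λ ℓ → Proper G ℓ × ClosedColoring G n k ℓ × order G ℓ ≡ r)
  × (∀ (ℓ : Labeling G) → Proper G ℓ → ClosedColoring G n k ℓ → r ≤ order G ℓ)

K : ℕ → Graph
K m = record { V = m ; adj = λ i j → not ⌊ i Fin.≟ j ⌋ }

S : ℕ → Graph
S m = record { V = suc m ; adj = a }
  where
  a : Fin (suc m) → Fin (suc m) → Bool
  a zero zero = false
  a zero (suc _) = true
  a (suc _) zero = true
  a (suc _) (suc _) = false

-- friendship graph F_m: centre zero; the 2m other vertices suc i, where
-- suc i and suc j (i ≠ j) form a triangle with the centre iff ⌊i/2⌋ = ⌊j/2⌋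
F : ℕ → Graph
F m = record { V = suc (2 ℕ.* m) ; adj = a }
  where
  a : Fin (suc (2 ℕ.* m)) → Fin (suc (2 ℕ.* m)) → Bool
  a zero zero = false
  a zero (suc _) = true
  a (suc _) zero = true
  a (suc i) (suc j) = not ⌊ i Fin.≟ j ⌋ ∧ ⌊ (toℕ i / 2) ℕ.≟ (toℕ j / 2) ⌋

-- Give vertex zero, adjacent to every other vertex in all three graphs, the label k,
-- and every other vertex a positive multiple of n exceeding ∣ k ∣. Every closed
-- neighbourhood contains the centre, so every closed sum is k plus multiples of n,
-- and no other label equals k. Choosing the other labels pairwise distinct (K_m),
-- all equal (S_m), or different on the two leaves of each triangle (F_m) makes the
-- labelling proper with m, 2 and 3 labels. No proper labelling can do better, since
-- the graphs contain cliques of these sizes and a clique gets pairwise distinct labels.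

{-# OPTIONS --safe #-}
module Submission where

open import Defs
open import Data.Nat using (ℕ; _≤_)
open import Data.Integer using (ℤ; +_)
open import Data.Product using (_×_; _,_)

open import Data.Bool using (Bool; true; false; if_then_else_)
open import Data.Bool.Properties using (T-≡; T-∧)
open import Data.Fin as Fin using (Fin; zero; suc; toℕ)
open import Data.Fin.Properties using (toℕ-injective; toℕ-fromℕ<)
open import Data.Integer as ℤ using (∣_∣)
open import Data.Integer.Divisibility using (_∣_)
import Data.Integer.Divisibility.Signed as Signed
open import Data.Integer.Properties using (+-injective; +-0-abelianGroup)
open import Algebra.Properties.AbelianGroup +-0-abelianGroup using (xyx⁻¹≈y)
open import Data.List using (List; []; _∷_; _++_; length; map; foldr; tabulate; deduplicate)
open import Data.List.Base using (allFin)
open import Data.List.Membership.Propositional using (_∈_)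
open import Data.List.Membership.Propositional.Properties
  using (∈-∃++; ∈-++⁻; ∈-++⁺ˡ; ∈-++⁺ʳ; ∈-map⁺; ∈-map⁻; ∈-allFin; ∈-deduplicate⁻; ∈-deduplicate⁺)
open import Data.List.Properties using (length-++; length-map; length-tabulate)
open import Data.List.Relation.Binary.Subset.Propositional using (_⊆_)
open import Data.List.Relation.Unary.All using (All; []; _∷_)
import Data.List.Relation.Unary.All as All
import Data.List.Relation.Unary.All.Properties as All
open import Data.List.Relation.Unary.AllPairs using (AllPairs; []; _∷_)
import Data.List.Relation.Unary.AllPairs as AllPairs
import Data.List.Relation.Unary.AllPairs.Properties as AllPairs
open import Data.List.Relation.Unary.Any using (here; there)
open import Data.List.Relation.Unary.Unique.Propositional using (Unique)
open import Data.List.Relation.Unary.Unique.Propositional.Properties using (allFin⁺)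
open import Data.List.Relation.Unary.Unique.DecPropositional.Properties using (deduplicate-!)
open import Data.Nat as ℕ using (suc; z≤n; s≤s; NonZero; >-nonZero)
open import Data.Nat.DivMod using (_/_; _%_; m≡m%n+[m/n]*n; m%n<n)
open import Data.Nat.Divisibility using (m∣m*n; _∣0)
open import Data.Nat.Properties
  using ( ≤-antisym; ≤-trans; ≤-reflexive; <-irrefl; +-suc; m≤m+n; m≤n*m; *-monoʳ-≤
        ; *-cancelˡ-≡; +-cancelˡ-≡; suc-injective; 0≢1+n; module ≤-Reasoning)
open import Data.Sum using (inj₁; inj₂)
open import Function using (_∘_; id)
open import Function.Bundles using (Equivalence)
open import Relation.Nullary using (contradiction)
open import Relation.Nullary.Decidable using (toWitness; fromWitness; toWitnessFalse; fromWitnessFalse)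
open import Relation.Binary.PropositionalEquality

Unique-⊆⇒length≤ : {A : Set} {xs ys : List A} → Unique xs → xs ⊆ ys → length xs ≤ length ys
Unique-⊆⇒length≤ {xs = []} _ _ = z≤n
Unique-⊆⇒length≤ {xs = x ∷ xs} (x∉xs ∷ !xs) x∷xs⊆ys with ∈-∃++ (x∷xs⊆ys (here refl))
... | us , vs , refl = begin
  suc (length xs)               ≤⟨ s≤s (Unique-⊆⇒length≤ !xs xs⊆us++vs) ⟩
  suc (length (us ++ vs))       ≡⟨ cong suc (length-++ us) ⟩
  suc (length us ℕ.+ length vs) ≡⟨ +-suc (length us) (length vs) ⟨
  length us ℕ.+ suc (length vs) ≡⟨ length-++ us ⟨
  length (us ++ x ∷ vs)         ∎
  where
  open ≤-Reasoning
  xs⊆us++vs : xs ⊆ us ++ vs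
  xs⊆us++vs y∈xs with ∈-++⁻ us (x∷xs⊆ys (there y∈xs))
  ... | inj₁ y∈us         = ∈-++⁺ˡ y∈us
  ... | inj₂ (here refl)  = contradiction refl (All.lookup x∉xs y∈xs)
  ... | inj₂ (there y∈vs) = ∈-++⁺ʳ us y∈vs

module _ (G : Graph) (ℓ : Labeling G) where

  order≤length : {L : List ℤ} → (∀ v → ℓ v ∈ L) → order G ℓ ≤ length L
  order≤length {L} ℓ∈L = Unique-⊆⇒length≤ (deduplicate-! ℤ._≟_ image) image⊆L
    where
    image : List ℤ
    image = map ℓ (allFin (V G))
    image⊆L : deduplicate ℤ._≟_ image ⊆ L
    image⊆L z∈ with ∈-map⁻ ℓ (∈-deduplicate⁻ ℤ._≟_ image z∈)
    ... | v , _ , refl = ℓ∈L v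

Clique : (G : Graph) → List (Fin (V G)) → Set
Clique G = AllPairs (λ v w → adj G v w ≡ true)

clique≤order : {G : Graph} {ℓ : Labeling G} {ws : List (Fin (V G))} →
               Proper G ℓ → Clique G ws → length ws ≤ order G ℓ
clique≤order {G} {ℓ} {ws} proper clique = begin
  length ws          ≡⟨ length-map ℓ ws ⟨
  length (map ℓ ws)  ≤⟨ Unique-⊆⇒length≤ labels-distinct labels⊆image ⟩
  order G ℓ          ∎
  where
  open ≤-Reasoning
  labels-distinct : Unique (map ℓ ws)
  labels-distinct = AllPairs.map⁺ (AllPairs.map (proper _ _) clique)
  labels⊆image : map ℓ ws ⊆ deduplicate ℤ._≟_ (map ℓ (allFin (V G)))
  labels⊆image z∈ with ∈-map⁻ ℓ z∈
  ... | w , _ , refl = ∈-deduplicate⁺ ℤ._≟_ (∈-map⁺ ℓ (∈-allFin w))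

χ-by-clique : (G : Graph) (n k : ℤ) (ℓ : Labeling G) (ws : List (Fin (V G))) →
              Proper G ℓ → ClosedColoring G n k ℓ → Clique G ws → order G ℓ ≤ length ws →
              χ[ n , k ] G ≡ length ws
χ-by-clique _ _ _ ℓ ws proper closed clique bound =
  (ℓ , proper , closed , ≤-antisym bound (clique≤order proper clique)) ,
  λ _ proper′ _ → clique≤order proper′ clique

-- The _∣_ used by ClosedColoring compares absolute values; closure under _+_ is
-- available in the library only for signed divisibility.
∣-foldr-+ : {d : ℤ} {xs : List ℤ} → All (d ∣_) xs → d ∣ foldr ℤ._+_ (+ 0) xs
∣-foldr-+ []            = _ ∣0
∣-foldr-+ {d} {x ∷ xs} (d∣x ∷ d∣xs) = Signed.∣⇒∣ᵤ {d} (Signed.∣m∣n⇒∣m+n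
  (Signed.∣ᵤ⇒∣ {d} {x} d∣x)
  (Signed.∣ᵤ⇒∣ {d} {foldr ℤ._+_ (+ 0) xs} (∣-foldr-+ {d} d∣xs)))

spokeLabel : ℕ → ℤ → ℕ → ℤ
spokeLabel n k t = + (n ℕ.* suc (∣ k ∣ ℕ.+ t))

module _ {n : ℕ} {k : ℤ} where

  +n∣spokeLabel : (t : ℕ) → + n ∣ spokeLabel n k t
  +n∣spokeLabel t = m∣m*n (suc (∣ k ∣ ℕ.+ t))

  module _ .{{_ : NonZero n}} where

    spokeLabel≢ : {t : ℕ} → spokeLabel n k t ≢ k
    spokeLabel≢ {t} eq = <-irrefl (sym (cong ∣_∣ eq)) ∣k∣<spoke
      where
      ∣k∣<spoke : ∣ k ∣ ℕ.< n ℕ.* suc (∣ k ∣ ℕ.+ t)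
      ∣k∣<spoke = ≤-trans (s≤s (m≤m+n ∣ k ∣ t)) (m≤n*m _ n)

    spokeLabel-injective : {s t : ℕ} → spokeLabel n k s ≡ spokeLabel n k t → s ≡ t
    spokeLabel-injective {s} {t} =
      +-cancelˡ-≡ ∣ k ∣ s t ∘ suc-injective ∘ *-cancelˡ-≡ _ _ n ∘ +-injective

module Centred {N : ℕ} (a : Fin (suc N) → Fin (suc N) → Bool) where

  G : Graph
  G = record { V = suc N ; adj = a }

  centredLabeling : ℕ → ℤ → (Fin N → ℕ) → Labeling G
  centredLabeling n k f zero    = k
  centredLabeling n k f (suc i) = spokeLabel n k (f i)

  module _ (centre-adj : ∀ i → a (suc i) zero ≡ true) (n : ℕ) (k : ℤ) (f : Fin N → ℕ) where

    private
      ℓ : Labeling G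
      ℓ = centredLabeling n k f

    centre∈N[_] : ∀ v → inN[ G ] v zero ≡ true
    centre∈N[ zero ]  = refl
    centre∈N[ suc i ] = centre-adj i

    centredLabeling-closed : ClosedColoring G (+ n) k ℓ
    centredLabeling-closed v =
      subst (+ n ∣_) spokes≡closedSum-k (∣-foldr-+ {+ n} (All.map⁺ (All.tabulate⁺ +n∣term)))
      where
      term : Fin (suc N) → ℤ
      term w = if inN[ G ] v w then ℓ w else + 0
      spokes : ℤ
      spokes = foldr ℤ._+_ (+ 0) (map term (tabulate suc))
      +n∣term : ∀ i → + n ∣ term (suc i)
      +n∣term i with inN[ G ] v (suc i)
      ... | true  = +n∣spokeLabel {n} {k} (f i)
      ... | false = n ∣0
      spokes≡closedSum-k : spokes ≡ closedSum G ℓ v ℤ.- k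
      spokes≡closedSum-k = begin
        spokes               ≡⟨ xyx⁻¹≈y k spokes ⟨
        k ℤ.+ spokes ℤ.- k   ≡⟨ cong (λ b → (if b then k else + 0) ℤ.+ spokes ℤ.- k) centre∈N[ v ] ⟨
        closedSum G ℓ v ℤ.- k ∎
        where open ≡-Reasoning

    centredLabeling-proper : .{{_ : NonZero n}} → a zero zero ≡ false →
                             (∀ i j → a (suc i) (suc j) ≡ true → f i ≢ f j) → Proper G ℓ
    centredLabeling-proper centre-irrefl _ zero zero adj-zz =
      contradiction (trans (sym centre-irrefl) adj-zz) λ ()
    centredLabeling-proper _ _ zero    (suc j) _ = spokeLabel≢ ∘ sym
    centredLabeling-proper _ _ (suc i) zero    _ = spokeLabel≢
    centredLabeling-proper _ leaves-differ (suc i) (suc j) adj-ij =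
      leaves-differ i j adj-ij ∘ spokeLabel-injective {k = k}

open Centred using (centredLabeling; centredLabeling-closed; centredLabeling-proper)

K-adj⇒≢ : ∀ {m} {i j : Fin m} → adj (K m) i j ≡ true → i ≢ j
K-adj⇒≢ = toWitnessFalse ∘ Equivalence.from T-≡

K-≢⇒adj : ∀ {m} {i j : Fin m} → i ≢ j → adj (K m) i j ≡ true
K-≢⇒adj = Equivalence.to T-≡ ∘ fromWitnessFalse

F-adj-leaves⇒ : ∀ {m} {i j : Fin (2 ℕ.* m)} → adj (F m) (suc i) (suc j) ≡ true →
                i ≢ j × toℕ i / 2 ≡ toℕ j / 2
F-adj-leaves⇒ {i = i} {j} adj-ij with Equivalence.to T-∧ (Equivalence.from T-≡ adj-ij)
... | i≢j , same-triangle =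
  toWitnessFalse {a? = i Fin.≟ j} i≢j , toWitness {a? = toℕ i / 2 ℕ.≟ toℕ j / 2} same-triangle

F-adj-leaves⇐ : ∀ {m} {i j : Fin (2 ℕ.* m)} → i ≢ j → toℕ i / 2 ≡ toℕ j / 2 →
                adj (F m) (suc i) (suc j) ≡ true
F-adj-leaves⇐ {i = i} {j} i≢j same-triangle = Equivalence.to T-≡ (Equivalence.from T-∧
  (fromWitnessFalse {a? = i Fin.≟ j} i≢j , fromWitness {a? = toℕ i / 2 ℕ.≟ toℕ j / 2} same-triangle))

/-%-injective : ∀ {a b} d .{{_ : NonZero d}} → a / d ≡ b / d → a % d ≡ b % d → a ≡ b
/-%-injective {a} {b} d same-quotient same-remainder = begin
  a                      ≡⟨ m≡m%n+[m/n]*n a d ⟩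
  a % d ℕ.+ a / d ℕ.* d  ≡⟨ cong₂ (λ r q → r ℕ.+ q ℕ.* d) same-remainder same-quotient ⟩
  b % d ℕ.+ b / d ℕ.* d  ≡⟨ m≡m%n+[m/n]*n b d ⟨
  b                      ∎
  where open ≡-Reasoning

module _ {n : ℕ} .{{_ : NonZero n}} (k : ℤ) (m : ℕ) where

  χ-K : χ[ + n , k ] K (suc m) ≡ suc m
  χ-K = subst (χ[ + n , k ] K (suc m) ≡_) (length-tabulate id)
          (χ-by-clique (K (suc m)) (+ n) k ℓ (allFin (suc m)) proper closed clique bound)
    where
    a = adj (K (suc m))
    ℓ : Labeling (K (suc m))
    ℓ = centredLabeling a n k toℕ
    proper : Proper (K (suc m)) ℓ
    proper = centredLabeling-proper a (λ _ → refl) n k toℕ refl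
               (λ i j adj-ij → K-adj⇒≢ adj-ij ∘ cong suc ∘ toℕ-injective)
    closed : ClosedColoring (K (suc m)) (+ n) k ℓ
    closed = centredLabeling-closed a (λ _ → refl) n k toℕ
    clique : Clique (K (suc m)) (allFin (suc m))
    clique = AllPairs.map K-≢⇒adj (allFin⁺ (suc m))
    bound : order (K (suc m)) ℓ ≤ length (allFin (suc m))
    bound = ≤-trans (order≤length (K (suc m)) ℓ (λ v → ∈-map⁺ ℓ (∈-allFin v)))
                    (≤-reflexive (length-map ℓ (allFin (suc m))))

  χ-S : χ[ + n , k ] S (suc m) ≡ 2
  χ-S = χ-by-clique (S (suc m)) (+ n) k ℓ (zero ∷ suc zero ∷ []) proper closed edge
          (order≤length (S (suc m)) ℓ image)
    where
    a = adj (S (suc m))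
    ℓ : Labeling (S (suc m))
    ℓ = centredLabeling a n k (λ _ → 0)
    proper : Proper (S (suc m)) ℓ
    proper = centredLabeling-proper a (λ _ → refl) n k (λ _ → 0) refl (λ _ _ ())
    closed : ClosedColoring (S (suc m)) (+ n) k ℓ
    closed = centredLabeling-closed a (λ _ → refl) n k (λ _ → 0)
    edge : Clique (S (suc m)) (zero ∷ suc zero ∷ [])
    edge = (refl ∷ []) ∷ [] ∷ []
    image : ∀ v → ℓ v ∈ k ∷ spokeLabel n k 0 ∷ []
    image zero    = here refl
    image (suc _) = there (here refl)

  χ-F : χ[ + n , k ] F (suc m) ≡ 3
  χ-F = χ-by-clique (F (suc m)) (+ n) k ℓ (zero ∷ suc zero ∷ suc one ∷ [])
          proper closed triangle
          (order≤length (F (suc m)) ℓ image)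
    where
    a = adj (F (suc m))
    parity : Fin (2 ℕ.* suc m) → ℕ
    parity i = toℕ i % 2
    ℓ : Labeling (F (suc m))
    ℓ = centredLabeling a n k parity
    proper : Proper (F (suc m)) ℓ
    proper = centredLabeling-proper a (λ _ → refl) n k parity refl leaves-differ
      where
      leaves-differ : ∀ i j → a (suc i) (suc j) ≡ true → parity i ≢ parity j
      leaves-differ i j adj-ij with F-adj-leaves⇒ {suc m} {i} {j} adj-ij
      ... | i≢j , same-triangle = i≢j ∘ toℕ-injective ∘ /-%-injective 2 same-triangle
    closed : ClosedColoring (F (suc m)) (+ n) k ℓ
    closed = centredLabeling-closed a (λ _ → refl) n k parity
    1<2[1+m] : 1 ℕ.< 2 ℕ.* suc m
    1<2[1+m] = *-monoʳ-≤ 2 (s≤s z≤n)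
    -- 2 * suc m does not reduce to the form suc (suc _), so vertex 1 is built with fromℕ<.
    one : Fin (2 ℕ.* suc m)
    one = Fin.fromℕ< 1<2[1+m]
    triangle : Clique (F (suc m)) (zero ∷ suc zero ∷ suc one ∷ [])
    triangle = (refl ∷ refl ∷ []) ∷ (F-adj-leaves⇐ {suc m} zero≢one same-triangle ∷ []) ∷ [] ∷ []
      where
      zero≢one : zero ≢ one
      zero≢one eq = 0≢1+n (trans (cong toℕ eq) (toℕ-fromℕ< 1<2[1+m]))
      same-triangle : 0 / 2 ≡ toℕ one / 2
      same-triangle = cong (_/ 2) (sym (toℕ-fromℕ< 1<2[1+m]))
    image : ∀ v → ℓ v ∈ k ∷ spokeLabel n k 0 ∷ spokeLabel n k 1 ∷ []
    image zero = here refl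
    image (suc i) with parity i | m%n<n (toℕ i) 2
    ... | 0 | _ = there (here refl)
    ... | 1 | _ = there (there (here refl))
    ... | suc (suc _) | s≤s (s≤s ())

theorem4p1 : (k : ℤ) (n m : ℕ) → 1 ≤ n → 1 ≤ m →
    (χ[ + n , k ] K m ≡ m) × (χ[ + n , k ] S m ≡ 2) × (χ[ + n , k ] F m ≡ 3)
theorem4p1 k n (suc m) 1≤n (s≤s z≤n) = χ-K k m , χ-S k m , χ-F k m
  where instance
  n≢0 : NonZero n
  n≢0 = >-nonZero 1≤n
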